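{- Let $n\ge1$, let $P_{n+1}$ be the path with vertices $1,\dots,n+1$ (edges $\{i,i+1\}$), and let $Q_{n+3}$ be a convex $(n+3)$-gon with vertices labeled $0,1,\dots,n+2$ in order along its boundary, with $1,\dots,n+1$ strictly below the edge $[0,n+2]$. For an internal diagonal $\delta=[i,j]$ of $Q_{n+3}$ ($0\le i<j\le n+2$, $j-i\ge2$, $(i,j)\ne(0,n+2)$), let $T_\delta=\{i+1,\dots,j-1\}$ be the set of vertices strictly below $\delta$, a proper tube of $P_{n+1}$. Then for any two internal diagonals $\delta,\delta'$: \[ \delta(T_\delta\,\|\,T_{\delta'})=\begin{cases}-1&\text{if }\delta=\delta',\\ 0&\text{if }\delta\neq\delta'\text{ do not cross},\\ 1&\text{if }\delta\ne\delta'\text{ cross.}\end{cases} \]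
   Context: A tube of a graph is a nonempty vertex subset inducing a connected subgraph. The compatibility degree of tubes $T,T'$ is $\delta(T\,\|\,T')=-1$ if $T=T'$; the number of vertices of $T'\setminus T$ adjacent to some vertex of $T$ if $T\not\subseteq T'$; and $0$ otherwise. Two diagonals cross if they intersect in their relative interiors. -}

module Defs where

open import Data.Bool using (Bool; true; false; _∧_; if_then_else_)
open import Data.Nat using (ℕ; zero; suc; _+_; _≤_; _<_; _≤?_) renaming (_≟_ to _≟N_)
open import Data.Fin using (Fin; toℕ)
open import Data.Fin.Properties using (any?)
open import Data.Fin.Subset using (Subset; Side; inside; outside; _∈_; _─_; _∩_; ∣_∣)
open import Data.Fin.Subset.Properties using (_∈?_; _⊆?_)
open import Data.Vec using (tabulate)
open import Data.Vec.Properties using (≡-dec)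
open import Data.Bool.Properties using () renaming (_≟_ to _≟B_)
open import Data.Integer using (ℤ; +_; -[1+_])
open import Data.Product using (_×_; _,_)
open import Data.Sum using (_⊎_)
open import Relation.Nullary using (Dec; yes; no; ¬_; does)
open import Relation.Nullary.Decidable using (_×-dec_; _⊎-dec_)
open import Relation.Binary.PropositionalEquality using (_≡_)

record Graph (m : ℕ) : Set₁ where
  field
    Adj  : Fin m → Fin m → Set
    adj? : (u v : Fin m) → Dec (Adj u v)

open Graph public

_≟S_ : {m : ℕ} → (S T : Subset m) → Dec (S ≡ T)
_≟S_ = ≡-dec _≟B_

nbhd : {m : ℕ} → Graph m → Subset m → Subset m
nbhd G T = tabulate λ v →
  if does (any? λ u → (u ∈? T) ×-dec adj? G u v) then inside else outside

compat : {m : ℕ} → Graph m → Subset m → Subset m → ℤ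
compat G T T' with T ≟S T'
... | yes _ = -[1+ 0 ]
... | no _ with T ⊆? T'
...   | yes _ = + 0
...   | no _  = + ∣ (T' ─ T) ∩ nbhd G T ∣

-- The path P_{n+1}: vertex v : Fin (n+1) stands for the label toℕ v + 1 ∈ {1,…,n+1};
-- edges {i, i+1}.
Path : (n : ℕ) → Graph (suc n)
Path n = record
  { Adj  = λ u v → (suc (toℕ u) ≡ toℕ v) ⊎ (suc (toℕ v) ≡ toℕ u)
  ; adj? = λ u v → (suc (toℕ u) ≟N toℕ v) ⊎-dec (suc (toℕ v) ≟N toℕ u)
  }

InternalDiagonal : ℕ → ℕ → ℕ → Set
InternalDiagonal n i j = (i + 2 ≤ j) × (j ≤ n + 2) × ¬ ((i ≡ 0) × (j ≡ n + 2))

-- T_[i,j] = {i+1,…,j-1}: vertex v (label toℕ v + 1) lies in it iff i < toℕ v + 1 < j.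
tubeOf : (n i j : ℕ) → Subset (suc n)
tubeOf n i j = tabulate λ v →
  if does (i ≤? toℕ v) ∧ does (toℕ v + 2 ≤? j) then inside else outside

-- Diagonals [i,j], [k,l] of a convex polygon (vertices in convex position, labelled in
-- boundary order) cross, i.e. meet in their relative interiors, iff their endpoints
-- strictly interleave along the boundary.
Cross : ℕ → ℕ → ℕ → ℕ → Set
Cross i j k l = ((i < k) × (k < j) × (j < l)) ⊎ ((k < i) × (i < l) × (l < j))

module Submission where

-- Label the vertices of the path 1, …, n+1, so that T_[i,j] is the open interval (i,j). When
-- T ⊈ T', δ(T ‖ T') counts the vertices outside T adjacent to it (those labelled i or j) that
-- lie in T' = T_[k,l]: the endpoints of [i,j] strictly inside (k,l). For non-crossing diagonals
-- such an endpoint forces k ≤ i and j ≤ l, i.e. T ⊆ T'; for crossing ones exactly one endpoint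
-- is inside.

open import Data.Bool using (Bool; true; false; T; _∧_; if_then_else_)
open import Data.Bool.Properties using (T-∧; T-≡)
open import Data.Empty using (⊥-elim)
open import Data.Fin using (Fin; toℕ; fromℕ<)
open import Data.Fin.Properties using (any?; toℕ-injective; toℕ-fromℕ<; toℕ<n)
open import Data.Fin.Subset using (Subset; inside; outside; _∈_; _∉_; _⊆_; _─_; _∩_; ⁅_⁆; ∣_∣; Empty)
open import Data.Fin.Subset.Properties
  using (_⊆?_; x∈p∩q⁺; x∈p∩q⁻; x∈p∧x∉q⇒x∈p─q; p─q⊆p; ⊆-antisym; ⊆-reflexive; x∈⁅y⁆⇔x≡y;
         Empty-unique; ∣⊥∣≡0; ∣⁅x⁆∣≡1)
open import Data.Integer using (+_; -[1+_])
open import Data.Nat using (ℕ; suc; _+_; _<_; _≤_; _≤?_; s≤s; s≤s⁻¹; z≤n; z<s)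
open import Data.Nat.Properties
  using (+-comm; ≤-refl; ≤-trans; ≤-antisym; <-trans; <-irrefl; <-asym; ≤-<-trans; <-≤-trans;
         <⇒≤; <⇒≱; ≮⇒≥; m≤n⇒m<n∨m≡n; m<n⇒m<1+n; n<1+n; suc-injective)
open import Data.Product using (_×_; _,_; ∃; proj₁; proj₂; uncurry)
open import Data.Sum using (_⊎_; inj₁; inj₂)
open import Data.Vec using (_∷_; tabulate; here; there)
open import Data.Vec.Properties using (lookup∘tabulate; []=⇒lookup; lookup⇒[]=)
open import Function using (_∘_)
open import Function.Bundles using (_⇔_; mk⇔; Equivalence)
open import Relation.Nullary using (Dec; yes; no; ¬_; does; contradiction)
open import Relation.Nullary.Decidable using (dec-true)
open import Relation.Binary.PropositionalEquality using (_≡_; _≢_; refl; sym; trans; cong; subst)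

open import Defs

open Equivalence using (to; from)

T-does⁻ : ∀ {a} {A : Set a} (a? : Dec A) → T (does a?) → A
T-does⁻ (yes a) _ = a

T-does⁺ : ∀ {a} {A : Set a} (a? : Dec A) → A → T (does a?)
T-does⁺ a? a = T-≡ .from (dec-true a? a)

∈-tabulate-if⁻ : ∀ {m} (b : Fin m → Bool) {x} →
  x ∈ tabulate (λ v → if b v then inside else outside) → T (b x)
∈-tabulate-if⁻ b {x} x∈
  with b x | trans (sym (lookup∘tabulate (λ v → if b v then inside else outside) x)) ([]=⇒lookup x∈)
... | true  | _  = _
... | false | ()

∈-tabulate-if⁺ : ∀ {m} (b : Fin m → Bool) {x} →
  T (b x) → x ∈ tabulate (λ v → if b v then inside else outside)
∈-tabulate-if⁺ b {x} bx = lookup⇒[]= x _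
  (trans (lookup∘tabulate _ x) (cong (λ c → if c then inside else outside) (T-≡ .to bx)))

x∈p─q⇒x∉q : ∀ {m} {p q : Subset m} {x} → x ∈ p ─ q → x ∉ q
x∈p─q⇒x∉q {p = inside ∷ _} {outside ∷ _} here       ()
x∈p─q⇒x∉q {p = _      ∷ _} {_       ∷ _} (there x∈) (there x∈q) = x∈p─q⇒x∉q x∈ x∈q

∈-nbhd⁻ : ∀ {m} (G : Graph m) {p v} → v ∈ nbhd G p → ∃ λ u → u ∈ p × Adj G u v
∈-nbhd⁻ G v∈ = T-does⁻ (any? _) (∈-tabulate-if⁻ _ v∈)

∈-nbhd⁺ : ∀ {m} (G : Graph m) {p u v} → u ∈ p → Adj G u v → v ∈ nbhd G p
∈-nbhd⁺ G {u = u} u∈ uv = ∈-tabulate-if⁺ _ (T-does⁺ (any? _) (u , u∈ , uv))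

frontier : ∀ {m} → Graph m → Subset m → Subset m → Subset m
frontier G p q = (q ─ p) ∩ nbhd G p

compat-self : ∀ {m} (G : Graph m) p → compat G p p ≡ -[1+ 0 ]
compat-self G p with p ≟S p
... | yes _   = refl
... | no p≢p = contradiction refl p≢p

compat-≡0 : ∀ {m} (G : Graph m) {p q} → p ≢ q →
  (¬ p ⊆ q → Empty (frontier G p q)) → compat G p q ≡ + 0
compat-≡0 {m} G {p} {q} p≢q empty with p ≟S q
... | yes p≡q = contradiction p≡q p≢q
... | no _ with p ⊆? q
...   | yes _   = refl
...   | no p⊈q = cong +_ (trans (cong ∣_∣ (Empty-unique (empty p⊈q))) (∣⊥∣≡0 m))

compat-≡1 : ∀ {m} (G : Graph m) {p q} x → p ≢ q → ¬ p ⊆ q →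
  (∀ {y} → y ∈ frontier G p q ⇔ y ≡ x) → compat G p q ≡ + 1
compat-≡1 G {p} {q} x p≢q p⊈q frontier≡x with p ≟S q
... | yes p≡q = contradiction p≡q p≢q
... | no _ with p ⊆? q
...   | yes p⊆q = ⊥-elim (p⊈q p⊆q)
...   | no _    = cong +_ (trans (cong ∣_∣ frontier≡⁅x⁆) (∣⁅x⁆∣≡1 x))
  where
  frontier≡⁅x⁆ : frontier G p q ≡ ⁅ x ⁆
  frontier≡⁅x⁆ = ⊆-antisym (λ y∈ → x∈⁅y⁆⇔x≡y .from (frontier≡x .to y∈))
                           (λ y∈ → frontier≡x .from (x∈⁅y⁆⇔x≡y .to y∈))

label : ∀ {n} → Fin (suc n) → ℕ
label v = suc (toℕ v)

label-injective : ∀ {n} {u v : Fin (suc n)} → label u ≡ label v → u ≡ v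
label-injective = toℕ-injective ∘ suc-injective

vertexLabelled : ∀ {n m} → 0 < m → m ≤ suc n → ∃ λ (v : Fin (suc n)) → label v ≡ m
vertexLabelled {m = suc _} _ m<1+n = fromℕ< m<1+n , cong suc (toℕ-fromℕ< m<1+n)

Path-adj⁻ : ∀ {n} {u v : Fin (suc n)} → Adj (Path n) u v →
  suc (label u) ≡ label v ⊎ suc (label v) ≡ label u
Path-adj⁻ (inj₁ e) = inj₁ (cong suc e)
Path-adj⁻ (inj₂ e) = inj₂ (cong suc e)

∈-tubeOf⁻ : ∀ {n} i j {v : Fin (suc n)} → v ∈ tubeOf n i j → i < label v × label v < j
∈-tubeOf⁻ i j {v} v∈
  with T-∧ .to (∈-tabulate-if⁻ (λ v → does (i ≤? toℕ v) ∧ does (toℕ v + 2 ≤? j)) v∈)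
... | i≤v , v+2≤j = s≤s (T-does⁻ (i ≤? toℕ v) i≤v)
                  , subst (_≤ j) (+-comm (toℕ v) 2) (T-does⁻ (toℕ v + 2 ≤? j) v+2≤j)

∈-tubeOf⁺ : ∀ {n} i j {v : Fin (suc n)} → i < label v → label v < j → v ∈ tubeOf n i j
∈-tubeOf⁺ i j {v} (s≤s i≤v) v<j =
  ∈-tabulate-if⁺ (λ v → does (i ≤? toℕ v) ∧ does (toℕ v + 2 ≤? j))
    (T-∧ .from (T-does⁺ (i ≤? toℕ v) i≤v
              , T-does⁺ (toℕ v + 2 ≤? j) (subst (_≤ j) (+-comm 2 (toℕ v)) v<j)))

tubeOf-mono : ∀ {n i j k l} → k ≤ i → j ≤ l → tubeOf n i j ⊆ tubeOf n k l
tubeOf-mono {i = i} {j} {k} {l} k≤i j≤l v∈ with ∈-tubeOf⁻ i j v∈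
... | i<v , v<j = ∈-tubeOf⁺ k l (≤-<-trans k≤i i<v) (<-≤-trans v<j j≤l)

-- A chord [i,j] of Q_{n+3} with j - i ≥ 2: an internal diagonal or the edge [0,n+2], whose tube
-- is the whole path.
Chord : ℕ → ℕ → ℕ → Set
Chord n i j = suc i < j × j ≤ suc (suc n)

InternalDiagonal⇒Chord : ∀ {n i j} → InternalDiagonal n i j → Chord n i j
InternalDiagonal⇒Chord {n} {i} {j} (i+2≤j , j≤n+2 , _) =
  subst (_≤ j) (+-comm i 2) i+2≤j , subst (j ≤_) (+-comm n 2) j≤n+2

tubeOf-⊆⁻ : ∀ {n i j k l} → Chord n i j → tubeOf n i j ⊆ tubeOf n k l → k ≤ i × j ≤ l
tubeOf-⊆⁻ {i = i} {k = k} {l} (s≤s i<j' , s≤s j'≤1+n) ⊆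
  with vertexLabelled z<s (≤-trans i<j' j'≤1+n) | vertexLabelled (≤-<-trans z≤n i<j') j'≤1+n
... | first , refl | last , refl =
  s≤s⁻¹ (proj₁ (∈-tubeOf⁻ k l (⊆ (∈-tubeOf⁺ _ _ ≤-refl (s≤s i<j')))))
  , proj₂ (∈-tubeOf⁻ k l (⊆ (∈-tubeOf⁺ _ _ i<j' ≤-refl)))

tubeOf-injective : ∀ {n i j k l} → Chord n i j → Chord n k l →
  tubeOf n i j ≡ tubeOf n k l → i ≡ k × j ≡ l
tubeOf-injective c c' eq with tubeOf-⊆⁻ c (⊆-reflexive eq) | tubeOf-⊆⁻ c' (⊆-reflexive (sym eq))
... | k≤i , j≤l | i≤k , l≤j = ≤-antisym i≤k k≤i , ≤-antisym j≤l l≤j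

adjacent∉interval⇒endpoint : ∀ {i j a b} → i < a → a < j → suc a ≡ b ⊎ suc b ≡ a →
  ¬ (i < b × b < j) → b ≡ i ⊎ b ≡ j
adjacent∉interval⇒endpoint i<a a<j (inj₁ refl) b∉ with m≤n⇒m<n∨m≡n a<j
... | inj₁ b<j = contradiction (m<n⇒m<1+n i<a , b<j) b∉
... | inj₂ b≡j = inj₂ b≡j
adjacent∉interval⇒endpoint i<a a<j (inj₂ refl) b∉ with m≤n⇒m<n∨m≡n (s≤s⁻¹ i<a)
... | inj₁ i<b = contradiction (i<b , <-trans (n<1+n _) a<j) b∉
... | inj₂ i≡b = inj₁ (sym i≡b)

tubeOf-nbhd⁻ : ∀ {n i j} {y : Fin (suc n)} →
  y ∈ nbhd (Path n) (tubeOf n i j) → y ∉ tubeOf n i j → label y ≡ i ⊎ label y ≡ j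
tubeOf-nbhd⁻ {n} {i} {j} y∈ y∉ with ∈-nbhd⁻ (Path n) y∈
... | u , u∈ , uy with ∈-tubeOf⁻ i j u∈
...   | i<u , u<j = adjacent∉interval⇒endpoint i<u u<j (Path-adj⁻ uy)
                      (λ (i<y , y<j) → y∉ (∈-tubeOf⁺ i j i<y y<j))

tubeOf-nbhd⁺ : ∀ {n i j} {y : Fin (suc n)} → Chord n i j → label y ≡ i ⊎ label y ≡ j →
  y ∈ nbhd (Path n) (tubeOf n i j)
tubeOf-nbhd⁺ {n} {y = y} (1+i<j , j≤) (inj₁ y≡i)
  with vertexLabelled z<s (s≤s⁻¹ (≤-trans 1+i<j j≤))
... | u , refl = ∈-nbhd⁺ (Path n) (∈-tubeOf⁺ _ _ ≤-refl 1+i<j) (inj₂ y≡i)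
tubeOf-nbhd⁺ {n} {i} {y = y} (s≤s i<y' , _) (inj₂ refl)
  with vertexLabelled (≤-<-trans z≤n i<y') (<⇒≤ (toℕ<n y))
... | u , u≡y' = ∈-nbhd⁺ (Path n)
  (∈-tubeOf⁺ _ _ (subst (i <_) (sym u≡y') i<y') (subst (_< label y) (sym u≡y') ≤-refl)) (inj₁ u≡y')

endpoint∉tubeOf : ∀ {n i j} {y : Fin (suc n)} → label y ≡ i ⊎ label y ≡ j → y ∉ tubeOf n i j
endpoint∉tubeOf {i = i} {j} (inj₁ y≡i) y∈ = <-irrefl (sym y≡i) (proj₁ (∈-tubeOf⁻ i j y∈))
endpoint∉tubeOf {i = i} {j} (inj₂ y≡j) y∈ = <-irrefl y≡j (proj₂ (∈-tubeOf⁻ i j y∈))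

EndpointWithin : ℕ → ℕ → ℕ → ℕ → ℕ → Set
EndpointWithin i j k l m = (m ≡ i ⊎ m ≡ j) × k < m × m < l

frontier-tubeOf⇔ : ∀ {n i j k l} {y : Fin (suc n)} → Chord n i j →
  y ∈ frontier (Path n) (tubeOf n i j) (tubeOf n k l) ⇔ EndpointWithin i j k l (label y)
frontier-tubeOf⇔ {n} {i} {j} {k} {l} c = mk⇔ to′ from′
  where
  to′ : ∀ {y} → y ∈ frontier (Path n) (tubeOf n i j) (tubeOf n k l) →
        EndpointWithin i j k l (label y)
  to′ y∈ with x∈p∩q⁻ (tubeOf n k l ─ tubeOf n i j) _ y∈
  ... | y∈q─p , y∈N = tubeOf-nbhd⁻ y∈N (x∈p─q⇒x∉q y∈q─p) , ∈-tubeOf⁻ k l (p─q⊆p _ _ y∈q─p)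
  from′ : ∀ {y} → EndpointWithin i j k l (label y) →
          y ∈ frontier (Path n) (tubeOf n i j) (tubeOf n k l)
  from′ (endpoint , k<y , y<l) =
    x∈p∩q⁺ ( x∈p∧x∉q⇒x∈p─q (∈-tubeOf⁺ k l k<y y<l) (endpoint∉tubeOf endpoint)
           , tubeOf-nbhd⁺ c endpoint)

EndpointWithin∧¬Cross⇒nested : ∀ {i j k l m} → EndpointWithin i j k l m → ¬ Cross i j k l →
  k ≤ i × j ≤ l
EndpointWithin∧¬Cross⇒nested (inj₁ refl , k<i , i<l) ¬cross =
  <⇒≤ k<i , ≮⇒≥ (λ l<j → ¬cross (inj₂ (k<i , i<l , l<j)))
EndpointWithin∧¬Cross⇒nested (inj₂ refl , k<j , j<l) ¬cross =
  ≮⇒≥ (λ i<k → ¬cross (inj₁ (i<k , k<j , j<l))) , <⇒≤ j<l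

Cross⇒¬nested : ∀ {i j k l} → Cross i j k l → ¬ (k ≤ i × j ≤ l)
Cross⇒¬nested (inj₁ (i<k , _ , _)) (k≤i , _) = <⇒≱ i<k k≤i
Cross⇒¬nested (inj₂ (_ , _ , l<j)) (_ , j≤l) = <⇒≱ l<j j≤l

Cross⇒∃!EndpointWithin : ∀ {i j k l} → Cross i j k l →
  ∃ λ m → ∀ {m'} → EndpointWithin i j k l m' ⇔ m' ≡ m
Cross⇒∃!EndpointWithin {i} {j} (inj₁ (i<k , k<j , j<l)) = j , mk⇔
  (λ { (inj₁ refl , k<i , _) → contradiction k<i (<-asym i<k) ; (inj₂ refl , _) → refl })
  (λ { refl → inj₂ refl , k<j , j<l })
Cross⇒∃!EndpointWithin {i} {j} (inj₂ (k<i , i<l , l<j)) = i , mk⇔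
  (λ { (inj₁ refl , _) → refl ; (inj₂ refl , _ , j<l) → contradiction j<l (<-asym l<j) })
  (λ { refl → inj₁ refl , k<i , i<l })

compat-tubeOf-nonCrossing : ∀ {n i j k l} → Chord n i j → Chord n k l → ¬ (i ≡ k × j ≡ l) →
  ¬ Cross i j k l → compat (Path n) (tubeOf n i j) (tubeOf n k l) ≡ + 0
compat-tubeOf-nonCrossing {n} c c' distinct ¬cross =
  compat-≡0 (Path n) (distinct ∘ tubeOf-injective c c') λ T⊈T' (y , y∈) →
    T⊈T' (uncurry tubeOf-mono (EndpointWithin∧¬Cross⇒nested (frontier-tubeOf⇔ c .to y∈) ¬cross))

compat-tubeOf-crossing : ∀ {n i j k l} → Chord n i j → Chord n k l → Cross i j k l →
  compat (Path n) (tubeOf n i j) (tubeOf n k l) ≡ + 1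
compat-tubeOf-crossing {n} {i} {j} {k} {l} c (_ , l≤) cross with Cross⇒∃!EndpointWithin cross
... | m , within⇔ with within⇔ .from refl
...   | _ , k<m , m<l with vertexLabelled (≤-<-trans z≤n k<m) (s≤s⁻¹ (≤-trans m<l l≤))
...     | x , refl = compat-≡1 (Path n) x (λ eq → T⊈T' (⊆-reflexive eq)) T⊈T'
  (mk⇔ (λ y∈ → label-injective (within⇔ .to (frontier-tubeOf⇔ c .to y∈)))
       (λ { refl → frontier-tubeOf⇔ c .from (within⇔ .from refl) }))
  where
  T⊈T' : ¬ tubeOf n i j ⊆ tubeOf n k l
  T⊈T' = Cross⇒¬nested cross ∘ tubeOf-⊆⁻ c

proposition4p1 : (n : ℕ) → 1 ≤ n → (i j k l : ℕ) →
    InternalDiagonal n i j → InternalDiagonal n k l →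
    ((i ≡ k) × (j ≡ l) → compat (Path n) (tubeOf n i j) (tubeOf n k l) ≡ -[1+ 0 ])
    × (¬ ((i ≡ k) × (j ≡ l)) → ¬ Cross i j k l → compat (Path n) (tubeOf n i j) (tubeOf n k l) ≡ + 0)
    × (¬ ((i ≡ k) × (j ≡ l)) → Cross i j k l → compat (Path n) (tubeOf n i j) (tubeOf n k l) ≡ + 1)
proposition4p1 n _ i j k l δ δ' =
    (λ { (refl , refl) → compat-self (Path n) (tubeOf n i j) })
  , compat-tubeOf-nonCrossing c c'
  , λ _ → compat-tubeOf-crossing c c'
  where
  c : Chord n i j
  c = InternalDiagonal⇒Chord δ
  c' : Chord n k l
  c' = InternalDiagonal⇒Chord δ'
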